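{- For each $k\geq 3$, the graph $G_k$ defined below satisfies $o(G_k)=\mathcal{R}$ and $R_{\rm MB}(G_k)>\dim(G_k)$.
   Context: For $k\geq3$, $G_k$ is the graph with vertex set $A\cup B\cup C$, where $A,B,C$ are pairwise disjoint, $|A|=k$, $B=\{b_S:\emptyset\neq S\subseteq A\}$, $C=\{c_S:\emptyset\neq S\subseteq A\}$. Each of $A,B,C$ induces a clique; $b_S$ is adjacent to every vertex of $S$; $b_S$ is adjacent to $c_S$; no other edges. A resolving set is $W\subseteq V(G)$ such that for all distinct $x,y$ some $z\in W$ has $d(x,z)\neq d(y,z)$; $\dim(G)$ is the minimum size of a resolving set. In the Maker-Breaker resolving game, Resolver and Spoiler alternately select (without skipping) a not-yet-selected vertex; Resolver wins if at some point his vertices form a resolving set, otherwise Spoiler wins. $o(G)=\mathcal{R}$ means Resolver has a winning strategy whether he moves first or second. $R_{\rm MB}(G)$ is the minimum number of moves Resolver needs to win when he moves first (if he has a winning strategy; $\infty$ otherwise). -}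

module Defs where

open import Data.Nat using (ℕ; zero; suc; _≤_; _<_)
open import Data.Fin using (Fin)
open import Data.Fin.Subset using (Subset; _∈_; Nonempty)
open import Data.List using (List; []; _∷_; length)
import Data.List.Membership.Propositional as LM
open import Data.List.Relation.Unary.Unique.Propositional using (Unique)
open import Data.Product using (Σ; ∃; ∃-syntax; _×_; _,_)
open import Data.Sum using (_⊎_)
open import Data.Empty using (⊥)
open import Relation.Binary.PropositionalEquality using (_≡_; _≢_)

data Walk {V : Set} (E : V → V → Set) : V → V → ℕ → Set where
  nil  : ∀ {x} → Walk E x x zero
  cons : ∀ {x y z n} → E x y → Walk E y z n → Walk E x z (suc n)

IsDist : {V : Set} (E : V → V → Set) → V → V → ℕ → Set
IsDist E x y m = Walk E x y m × (∀ m′ → Walk E x y m′ → m ≤ m′)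

Distinguishes : {V : Set} (E : V → V → Set) → V → V → V → Set
Distinguishes E z x y =
  Σ ℕ λ m₁ → Σ ℕ λ m₂ → IsDist E x z m₁ × IsDist E y z m₂ × m₁ ≢ m₂

-- W (a list of vertices, read as a set) is a resolving set.
Resolving : {V : Set} (E : V → V → Set) → List V → Set
Resolving {V} E W = ∀ (x y : V) → x ≢ y →
  Σ V λ z → z LM.∈ W × Distinguishes E z x y

IsMetricDim : {V : Set} (E : V → V → Set) → ℕ → Set
IsMetricDim E d =
  (Σ _ λ W → Unique W × length W ≡ d × Resolving E W) ×
  (∀ W → Unique W → Resolving E W → d ≤ length W)

-- Maker–Breaker resolving game.
-- A state is (R , S): the vertices selected so far by Resolver and by
-- Spoiler.  A vertex is free if selected by neither.

Free : {V : Set} → List V → List V → V → Set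
Free R S v = (v LM.∉ R) × (v LM.∉ S)

-- ResolverWins E R S m : it is Resolver's turn in state (R , S) and
-- Resolver has a strategy that guarantees that his vertices form a
-- resolving set after at most m further moves of his.
-- Resolver must move (picks a free vertex v); if then his vertices are
-- resolving he has won; otherwise Spoiler must move, and if there is no
-- free vertex left the game is over (Spoiler wins), so Resolver must
-- guarantee a win after every possible reply of Spoiler.
data ResolverWins {V : Set} (E : V → V → Set) : List V → List V → ℕ → Set where
  won  : ∀ {R S m} → Resolving E R → ResolverWins E R S m
  move : ∀ {R S m} (v : V) → Free R S v →
         (Resolving E (v ∷ R) ⊎
           ((Σ V λ w → Free (v ∷ R) S w) ×
            (∀ w → Free (v ∷ R) S w → ResolverWins E (v ∷ R) (w ∷ S) m))) →
         ResolverWins E R S (suc m)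

ResolverWinsFirst : {V : Set} (E : V → V → Set) → Set
ResolverWinsFirst E = Σ ℕ λ m → ResolverWins E [] [] m

ResolverWinsSecond : {V : Set} (E : V → V → Set) → Set
ResolverWinsSecond {V} E = ∀ (w : V) → Σ ℕ λ m → ResolverWins E [] (w ∷ []) m

OutcomeResolver : {V : Set} (E : V → V → Set) → Set
OutcomeResolver E = ResolverWinsFirst E × ResolverWinsSecond E

IsRMB : {V : Set} (E : V → V → Set) → ℕ → Set
IsRMB E r = ResolverWins E [] [] r × (∀ m → ResolverWins E [] [] m → r ≤ m)

data VG (k : ℕ) : Set where
  a : Fin k → VG k
  b : (S : Subset k) → .(Nonempty S) → VG k
  c : (S : Subset k) → .(Nonempty S) → VG k

data AdjG {k : ℕ} : VG k → VG k → Set where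
  aa : ∀ {i j} → i ≢ j → AdjG (a i) (a j)
  bb : ∀ {S T p q} → S ≢ T → AdjG (b S p) (b T q)
  cc : ∀ {S T p q} → S ≢ T → AdjG (c S p) (c T q)
  ab : ∀ {i S p} → i ∈ S → AdjG (a i) (b S p)
  ba : ∀ {i S p} → i ∈ S → AdjG (b S p) (a i)
  bc : ∀ {S p q} → AdjG (b S p) (c S q)
  cb : ∀ {S p q} → AdjG (c S p) (b S q)

module Submission where

-- In the Maker–Breaker resolving game Resolver's
-- final set is a resolving set avoiding Spoiler's vertices; so if Spoiler can
-- answer any first move by stealing a vertex that lies in every resolving set
-- of size at most r, Resolver cannot win within r moves.  On finite graphs the
-- game is decidable (so R_MB is a genuine minimum), and Resolver wins by a
-- pairing strategy whenever meeting every pair of some pairing resolves.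
--
-- We compute its distances and show that A resolves and that
-- meeting every pair {b_S , c_S} resolves, whence o(G_k) = 𝓡.  The key lemma
-- (module AvoidingA): a resolving set missing some a_i has at least k + 1
-- vertices, one in each of k disjoint "blocks" of sets around A ∖ {i , l} and
-- one more.  Hence dim(G_k) = k, and a Spoiler stealing some a_i other than
-- Resolver's first vertex forces R_MB(G_k) ≥ k + 1.

open import Defs
open import Data.Nat using (ℕ; zero; suc; _+_; _≤_; _<_; z≤n; s≤s) renaming (_≟_ to _≟ℕ_)
open import Data.Nat.Properties
  using (≤-refl; ≤-trans; ≤-antisym; ≤-reflexive; ≤-pred; m≤n⇒m≤1+n; m≤m+n; ≤-<-trans;
         +-suc; suc-injective; +-monoʳ-≤; ≮⇒≥; ≤⇒≯; <⇒≤; ≰⇒>; _≤?_; anyUpTo?)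
open import Data.Nat.Induction using (<-rec)
open import Data.Fin using (Fin; zero; suc; fromℕ<) renaming (_≟_ to _≟ᶠ_)
open import Data.Fin.Subset using (Subset; Nonempty; ⁅_⁆; ⊤; ∁; _∪_; inside; outside; _⊆_)
  renaming (_∈_ to _∈ₛ_; _∉_ to _∉ₛ_)
open import Data.Fin.Subset.Properties
  using (x∈⁅x⁆; x∈⁅y⁆⇒x≡y; ∈⊤; nonempty?; ⊆-antisym; x∈p∪q⁺; x∈p∪q⁻; x∈∁p⇒x∉p; x∉p⇒x∈∁p)
  renaming (_∈?_ to _∈ₛ?_)
open import Data.Bool.Properties using () renaming (_≟_ to _≟ᵇ_)
open import Data.Vec.Properties using (≡-dec)
open import Data.Fin.Properties using (injective⇒≤; ¬∀⟶∃¬) renaming (any? to anyᶠ?; all? to allᶠ?)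
open import Data.List using (List; []; _∷_; length; lookup; map; _++_; concatMap; allFin)
open import Data.List.Membership.Propositional.Properties
  using (∈-++⁺ˡ; ∈-++⁺ʳ; ∈-map⁺; ∈-allFin; ∈-concatMap⁺)
open import Data.Vec using ([]; _∷_)
open import Data.List.Membership.Propositional using (_∈_; _∉_; find; lose)
open import Data.List.Relation.Unary.Any using (here; there; index; any?)
open import Data.List.Relation.Unary.Any.Properties using (lookup-index)
open import Data.List.Relation.Unary.All as All using (all?)
open import Data.List.Relation.Unary.Unique.Propositional using (Unique)
open import Data.List.Relation.Unary.Unique.Propositional.Properties using (map⁺; allFin⁺)
open import Data.List.Properties using (length-map; length-tabulate)
open import Data.Product using (Σ; _×_; _,_; proj₁; proj₂)
open import Data.Sum using (_⊎_; inj₁; inj₂)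
open import Data.Empty using (⊥; ⊥-elim; ⊥-elim-irr)
open import Data.Unit using (tt) renaming (⊤ to Unit)
open import Data.Maybe using (Maybe; just; nothing)
open import Data.Maybe.Properties using (just-injective) renaming (≡-dec to ≡-decᵐ)
open import Function using (_∘_)
open import Relation.Nullary using (Dec; yes; no; ¬_)
open import Relation.Nullary.Decidable using (_×-dec_; _⊎-dec_; _→-dec_; ¬?; map′)
open import Relation.Binary.Definitions using (DecidableEquality)
open import Relation.Binary.PropositionalEquality using (_≡_; _≢_; refl; sym; trans; cong; subst)

δ : {P : Set} → Dec P → ℕ
δ (yes _) = 0
δ (no _) = 1

δ-yes : {P : Set} (d : Dec P) → P → δ d ≡ 0
δ-yes (yes _) _ = refl
δ-yes (no ¬p) p = ⊥-elim (¬p p)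

δ-no : {P : Set} (d : Dec P) → ¬ P → δ d ≡ 1
δ-no (yes p) ¬p = ⊥-elim (¬p p)
δ-no (no _) _ = refl

δ≤1 : {P : Set} (d : Dec P) → δ d ≤ 1
δ≤1 (yes _) = z≤n
δ≤1 (no _) = s≤s z≤n

δ-agree : {P Q : Set} (p : Dec P) (q : Dec Q) → (P → Q) → (Q → P) → δ p ≡ δ q
δ-agree (yes _) (yes _) _ _ = refl
δ-agree (yes p) (no ¬q) P→Q _ = ⊥-elim (¬q (P→Q p))
δ-agree (no ¬p) (yes q) _ Q→P = ⊥-elim (¬p (Q→P q))
δ-agree (no _) (no _) _ _ = refl

δ-differ : {P Q : Set} (p : Dec P) (q : Dec Q) → P → ¬ Q → δ p ≢ δ q
δ-differ p q P ¬Q eq with trans (sym (δ-yes p P)) (trans eq (δ-no q ¬Q))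
... | ()

injection⇒≤length : {A : Set} {n : ℕ} (W : List A) (f : Fin n → A) →
  (∀ {x y} → f x ≡ f y → x ≡ y) → (∀ j → f j ∈ W) → n ≤ length W
injection⇒≤length W f f-injective f∈W = injective⇒≤ position-injective
  where
  position-injective : ∀ {x y} → index (f∈W x) ≡ index (f∈W y) → x ≡ y
  position-injective {x} {y} eq = f-injective
    (trans (lookup-index (f∈W x)) (trans (cong (lookup W) eq) (sym (lookup-index (f∈W y)))))

IsLeast : (ℕ → Set) → ℕ → Set
IsLeast P r = P r × (∀ m → P m → r ≤ m)

least-witness : (P : ℕ → Set) → (∀ n → Dec (P n)) → ∀ n → P n → Σ ℕ (IsLeast P)
least-witness P P? = <-rec (λ n → P n → Σ ℕ (IsLeast P)) search
  where
  search : ∀ n → (∀ {m} → m < n → P m → Σ ℕ (IsLeast P)) → P n → Σ ℕ (IsLeast P)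
  search n smaller Pn with anyUpTo? P? n
  ... | yes (m , m<n , Pm) = smaller m<n Pm
  ... | no none = n , Pn , λ m Pm → ≮⇒≥ (λ m<n → none (m , m<n , Pm))

distinguishes-sym : {V : Set} {E : V → V → Set} {z x y : V} →
  Distinguishes E z x y → Distinguishes E z y x
distinguishes-sym (m₁ , m₂ , dist₁ , dist₂ , m₁≢m₂) =
  m₂ , m₁ , dist₂ , dist₁ , λ eq → m₁≢m₂ (sym eq)

module Reversal {V : Set} {E : V → V → Set} (E-sym : ∀ {x y} → E x y → E y x) where

  snoc : ∀ {x y z n} → Walk E x y n → E y z → Walk E x z (suc n)
  snoc nil e = cons e nil
  snoc (cons e w) e′ = cons e (snoc w e′)

  reverse : ∀ {x y n} → Walk E x y n → Walk E y x n
  reverse nil = nil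
  reverse (cons e w) = snoc (reverse w) (E-sym e)

module Distance {V : Set} (E : V → V → Set) (d : V → V → ℕ)
    (path : ∀ x y → Walk E x y (d x y))
    (shortest : ∀ {x y m} → Walk E x y m → d x y ≤ m) where

  isDist : ∀ x y → IsDist E x y (d x y)
  isDist x y = path x y , λ m w → shortest w

  isDist-unique : ∀ {x y m} → IsDist E x y m → m ≡ d x y
  isDist-unique {x} {y} (w , minimal) = ≤-antisym (minimal _ (path x y)) (shortest w)

  distinguishes : ∀ {z x y} → d x z ≢ d y z → Distinguishes E z x y
  distinguishes {z} {x} {y} ne = d x z , d y z , isDist x z , isDist y z , ne

  distinguishes⁻ : ∀ {z x y} → Distinguishes E z x y → d x z ≢ d y z
  distinguishes⁻ (m₁ , m₂ , dist₁ , dist₂ , ne) eq =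
    ne (trans (isDist-unique dist₁) (trans eq (sym (isDist-unique dist₂))))

  distinguishes-by : ∀ {z x y m n} → d x z ≡ m → d y z ≡ n → m ≢ n → Distinguishes E z x y
  distinguishes-by dxz≡m dyz≡n m≢n = distinguishes λ eq → m≢n (trans (sym dxz≡m) (trans eq dyz≡n))

  distinguishes? : ∀ z x y → Dec (Distinguishes E z x y)
  distinguishes? z x y = map′ distinguishes distinguishes⁻ (¬? (d x z ≟ℕ d y z))

  -- Every vertex is at distance 0 from itself only, so it distinguishes
  -- itself from any other vertex.
  self-distinguishes : ∀ {x y} → y ≢ x → Distinguishes E x x y
  self-distinguishes {x} {y} y≢x = distinguishes λ dxx≡dyx →
    y≢x (zero-walk (subst (Walk E y x) (trans (sym dxx≡dyx) d-refl) (path y x)))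
    where
    d-refl : d x x ≡ 0
    d-refl = ≤-antisym (shortest nil) z≤n
    zero-walk : Walk E y x 0 → y ≡ x
    zero-walk nil = refl

∉-∷ : {A : Set} {x y : A} {S : List A} → x ≢ y → x ∉ S → x ∉ y ∷ S
∉-∷ x≢y x∉S (here x≡y) = x≢y x≡y
∉-∷ x≢y x∉S (there x∈S) = x∉S x∈S

module _ {V : Set} {E : V → V → Set} where

  -- Resolver's final vertices form a resolving set: if he can win within
  -- m more moves from (R , S), there is a resolving set of size at most
  -- |R| + m avoiding any vertex u that Spoiler already owns.
  win⇒small-resolving-set : ∀ {u R S m} → u ∈ S → u ∉ R → ResolverWins E R S m →
    Σ (List V) λ W → Resolving E W × u ∉ W × length W ≤ length R + m
  win⇒small-resolving-set {R = R} {m = m} u∈S u∉R (won res) =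
    R , res , u∉R , m≤m+n (length R) m
  win⇒small-resolving-set {u} {R} {S} {suc m} u∈S u∉R (move v (v∉R , v∉S) outcome) =
    after-move outcome
    where
    u∉v∷R : u ∉ v ∷ R
    u∉v∷R = ∉-∷ (λ u≡v → v∉S (subst (_∈ S) u≡v u∈S)) u∉R
    one-more-move : suc (length R + m) ≡ length R + suc m
    one-more-move = sym (+-suc (length R) m)
    after-move : Resolving E (v ∷ R) ⊎
                 (Σ V (Free (v ∷ R) S) × (∀ w → Free (v ∷ R) S w → ResolverWins E (v ∷ R) (w ∷ S) m)) →
                 Σ (List V) λ W → Resolving E W × u ∉ W × length W ≤ length R + suc m
    after-move (inj₁ res) =
      v ∷ R , res , u∉v∷R , ≤-trans (s≤s (m≤m+n (length R) m)) (≤-reflexive one-more-move)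
    after-move (inj₂ ((w , w-free) , continue))
      with win⇒small-resolving-set (there u∈S) u∉v∷R (continue w w-free)
    ... | W , res , u∉W , |W|≤ = W , res , u∉W , ≤-trans |W|≤ (≤-reflexive one-more-move)

  -- If every first move v leaves Spoiler some u ≢ v that lies in every
  -- resolving set of size at most r, Resolver moving first cannot win
  -- within r moves: Spoiler simply answers v by u.
  no-win-within : ∀ {r} → V →
    (∀ v → Σ V λ u → u ≢ v × ∀ W → Resolving E W → u ∉ W → r < length W) →
    ∀ m → m ≤ r → ¬ ResolverWins E [] [] m
  no-win-within v₀ steal m m≤r (won res) with steal v₀
  ... | u , _ , forced = ≤⇒≯ z≤n (forced [] res λ ())
  no-win-within v₀ steal (suc m) m≤r (move v _ outcome) with steal v | outcome
  ... | u , u≢v , forced | inj₁ res = ≤⇒≯ (≤-trans (s≤s z≤n) m≤r) (forced (v ∷ []) res (∉-∷ u≢v λ ()))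
  ... | u , u≢v , forced | inj₂ (_ , continue)
    with win⇒small-resolving-set (here refl) (∉-∷ u≢v λ ()) (continue u (∉-∷ u≢v (λ ()) , λ ()))
  ... | W , res , u∉W , |W|≤ = ≤⇒≯ (≤-trans |W|≤ m≤r) (forced W res u∉W)

Meets : {V : Set} → (V → Set) → (V → V) → List V → Set
Meets Paired mate R = ∀ v → Paired v → v ∈ R ⊎ mate v ∈ R

module FiniteGraph {V : Set} (E : V → V → Set) (_≟_ : DecidableEquality V)
    (vertices : List V) (complete : ∀ v → v ∈ vertices)
    (distinguishes? : ∀ z x y → Dec (Distinguishes E z x y)) where

  open import Data.List.Membership.DecPropositional _≟_ using (_∈?_)

  ∃? : {Q : V → Set} → (∀ v → Dec (Q v)) → Dec (Σ V Q)
  ∃? Q? with any? Q? vertices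
  ... | yes found = let (v , _ , q) = find found in yes (v , q)
  ... | no none = no λ (v , q) → none (lose (complete v) q)

  ∀? : {Q : V → Set} → (∀ v → Dec (Q v)) → Dec (∀ v → Q v)
  ∀? Q? with all? Q? vertices
  ... | yes all = yes λ v → All.lookup all (complete v)
  ... | no ¬all = no λ every → ¬all (All.tabulate λ {v} _ → every v)

  resolving? : ∀ W → Dec (Resolving E W)
  resolving? W = ∀? λ x → ∀? λ y → ¬? (x ≟ y) →-dec distinguisher? x y
    where
    distinguisher? : ∀ x y → Dec (Σ V λ z → z ∈ W × Distinguishes E z x y)
    distinguisher? x y with any? (λ z → distinguishes? z x y) W
    ... | yes found = yes (find found)
    ... | no none = no λ (z , z∈W , dz) → none (lose z∈W dz)

  free? : ∀ R S v → Dec (Free R S v)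
  free? R S v = ¬? (v ∈? R) ×-dec ¬? (v ∈? S)

  -- Whether Resolver can force a win within m moves is decidable: the
  -- game tree is finite.
  resolverWins? : ∀ m R S → Dec (ResolverWins E R S m)
  resolverWins? m R S with resolving? R
  ... | yes res = yes (won res)
  resolverWins? zero R S | no ¬res = no λ { (won res) → ¬res res }
  resolverWins? (suc m) R S | no ¬res with ∃? good-move?
    where
    good-move? : ∀ v → Dec (Free R S v ×
      (Resolving E (v ∷ R) ⊎
        ((Σ V λ w → Free (v ∷ R) S w) ×
         (∀ w → Free (v ∷ R) S w → ResolverWins E (v ∷ R) (w ∷ S) m))))
    good-move? v = free? R S v ×-dec (resolving? (v ∷ R) ⊎-dec
      (∃? (free? (v ∷ R) S) ×-dec ∀? λ w → free? (v ∷ R) S w →-dec resolverWins? m (v ∷ R) (w ∷ S)))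
  ... | yes (v , v-free , outcome) = yes (move v v-free outcome)
  ... | no none = no λ { (won res) → ¬res res ; (move v v-free outcome) → none (v , v-free , outcome) }

  -- The number of entries of xs not claimed in R; it bounds the number
  -- of moves Resolver still has to make.
  #unclaimed : List V → List V → ℕ
  #unclaimed R [] = 0
  #unclaimed R (x ∷ xs) = δ (x ∈? R) + #unclaimed R xs

  #unclaimed-mono : ∀ v R xs → #unclaimed (v ∷ R) xs ≤ #unclaimed R xs
  #unclaimed-mono v R [] = z≤n
  #unclaimed-mono v R (x ∷ xs) = step (x ∈? v ∷ R) (x ∈? R) (#unclaimed-mono v R xs)
    where
    step : ∀ {m n} (d₁ : Dec (x ∈ v ∷ R)) (d₂ : Dec (x ∈ R)) → m ≤ n →
           δ d₁ + m ≤ δ d₂ + n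
    step (yes _) (yes _) m≤n = m≤n
    step (yes _) (no _) m≤n = m≤n⇒m≤1+n m≤n
    step (no x∉v∷R) (yes x∈R) _ = ⊥-elim (x∉v∷R (there x∈R))
    step (no _) (no _) m≤n = s≤s m≤n

  #unclaimed-strict : ∀ {v} R xs → v ∈ xs → v ∉ R → #unclaimed (v ∷ R) xs < #unclaimed R xs
  #unclaimed-strict {v} R (x ∷ xs) (here refl) v∉R =
    step (v ∈? v ∷ R) (v ∈? R) (#unclaimed-mono v R xs)
    where
    step : ∀ {m n} (d₁ : Dec (v ∈ v ∷ R)) (d₂ : Dec (v ∈ R)) → m ≤ n →
           δ d₁ + m < δ d₂ + n
    step _ (yes v∈R) _ = ⊥-elim (v∉R v∈R)
    step (yes _) (no _) m≤n = s≤s m≤n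
    step (no v∉v∷R) (no _) _ = ⊥-elim (v∉v∷R (here refl))
  #unclaimed-strict {v} R (x ∷ xs) (there v∈xs) v∉R =
    step (x ∈? v ∷ R) (x ∈? R) (#unclaimed-strict R xs v∈xs v∉R)
    where
    step : ∀ {m n} (d₁ : Dec (x ∈ v ∷ R)) (d₂ : Dec (x ∈ R)) → m < n →
           δ d₁ + m < δ d₂ + n
    step (yes _) (yes _) m<n = m<n
    step (yes _) (no _) m<n = m≤n⇒m≤1+n m<n
    step (no x∉v∷R) (yes x∈R) _ = ⊥-elim (x∉v∷R (there x∈R))
    step (no _) (no _) m<n = s≤s m<n

  -- The pairing strategy: if the vertices are partially paired by an
  -- involution `mate` so that meeting every pair resolves the graph,
  -- Resolver wins by answering each Spoiler move on a pair with its
  -- mate (and otherwise claiming a vertex of an unmet pair).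
  module Pairing (Paired : V → Set) (paired? : ∀ v → Dec (Paired v)) (mate : V → V)
      (mate-paired : ∀ {v} → Paired v → Paired (mate v))
      (mate-involutive : ∀ {v} → Paired v → mate (mate v) ≡ v)
      (mate-distinct : ∀ {v} → Paired v → mate v ≢ v)
      (meets⇒resolving : ∀ R → Meets Paired mate R → Resolving E R) where

    -- Invariant of the strategy, Resolver to move: every pair is met by
    -- Resolver or untouched by Spoiler.
    Safe : List V → List V → Set
    Safe R S = ∀ v → Paired v → (v ∈ R ⊎ mate v ∈ R) ⊎ (v ∉ S × mate v ∉ S)

    untouched : ∀ {R S v} → Safe R S → Paired v → v ∉ R → mate v ∉ R → v ∉ S × mate v ∉ S
    untouched safe pv v∉R mv∉R with safe _ pv
    ... | inj₁ (inj₁ v∈R) = ⊥-elim (v∉R v∈R)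
    ... | inj₁ (inj₂ mv∈R) = ⊥-elim (mv∉R mv∈R)
    ... | inj₂ both∉S = both∉S

    safe-claim : ∀ {R S} v → Safe R S → Safe (v ∷ R) S
    safe-claim v safe u pu with safe u pu
    ... | inj₁ (inj₁ u∈R) = inj₁ (inj₁ (there u∈R))
    ... | inj₁ (inj₂ mu∈R) = inj₁ (inj₂ (there mu∈R))
    ... | inj₂ both∉S = inj₂ both∉S

    safe-harmless : ∀ {R S w} → Safe R S → (Paired w → mate w ∈ R) → Safe R (w ∷ S)
    safe-harmless {R} {S} {w} safe met u pu with safe u pu
    ... | inj₁ meets = inj₁ meets
    ... | inj₂ (u∉S , mu∉S) with u ≟ w | mate u ≟ w
    ...   | yes refl | _ = inj₁ (inj₂ (met pu))
    ...   | no _ | yes refl = inj₁ (inj₁ (subst (_∈ R) (mate-involutive pu) (met (mate-paired pu))))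
    ...   | no u≢w | no mu≢w = inj₂ (∉-∷ u≢w u∉S , ∉-∷ mu≢w mu∉S)

    safe-answer : ∀ {R S w} → Safe R S → Safe (mate w ∷ R) (w ∷ S)
    safe-answer {R} {S} {w} safe u pu with u ≟ w | mate u ≟ w
    ... | yes refl | _ = inj₁ (inj₂ (here refl))
    ... | no _ | yes refl = inj₁ (inj₁ (here (sym (mate-involutive pu))))
    ... | no u≢w | no mu≢w with safe u pu
    ...   | inj₁ (inj₁ u∈R) = inj₁ (inj₁ (there u∈R))
    ...   | inj₁ (inj₂ mu∈R) = inj₁ (inj₂ (there mu∈R))
    ...   | inj₂ (u∉S , mu∉S) = inj₂ (∉-∷ u≢w u∉S , ∉-∷ mu≢w mu∉S)

    safe-full : ∀ {R S} → Safe R S → ¬ (Σ V (Free R S)) → Meets Paired mate R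
    safe-full {R} safe no-free u pu with u ∈? R | mate u ∈? R
    ... | yes u∈R | _ = inj₁ u∈R
    ... | no _ | yes mu∈R = inj₂ mu∈R
    ... | no u∉R | no mu∉R = ⊥-elim (no-free (u , u∉R , proj₁ (untouched safe pu u∉R mu∉R)))

    claim : ∀ n R S v → Free R S v → Safe (v ∷ R) S → #unclaimed R vertices ≤ n →
            ResolverWins E R S n
    answer : ∀ n R S w → Safe R S → Free R S w → #unclaimed R vertices ≤ n →
             ResolverWins E R (w ∷ S) n
    open-pair : ∀ n R S → Safe R S → #unclaimed R vertices ≤ n → ResolverWins E R S n

    claim zero R S v (v∉R , _) _ fuel =
      ⊥-elim (≤⇒≯ fuel (≤-<-trans z≤n (#unclaimed-strict R vertices (complete v) v∉R)))
    claim (suc n) R S v (v∉R , v∉S) safe fuel with ∃? (free? (v ∷ R) S)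
    ... | yes free-w =
      move v (v∉R , v∉S) (inj₂ (free-w , λ w w-free → answer n (v ∷ R) S w safe w-free fuel′))
      where
      fuel′ : #unclaimed (v ∷ R) vertices ≤ n
      fuel′ = ≤-pred (≤-trans (#unclaimed-strict R vertices (complete v) v∉R) fuel)
    ... | no no-free = move v (v∉R , v∉S) (inj₁ (meets⇒resolving (v ∷ R) (safe-full safe no-free)))

    answer n R S w safe (w∉R , w∉S) fuel with paired? w
    ... | no ¬pw = open-pair n R (w ∷ S) (safe-harmless safe λ pw → ⊥-elim (¬pw pw)) fuel
    ... | yes pw with mate w ∈? R
    ...   | yes mw∈R = open-pair n R (w ∷ S) (safe-harmless safe λ _ → mw∈R) fuel
    ...   | no mw∉R = claim n R (w ∷ S) (mate w) (mw∉R , mw∉w∷S) (safe-answer safe) fuel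
      where
      mw∉w∷S : mate w ∉ w ∷ S
      mw∉w∷S = ∉-∷ (mate-distinct pw) (proj₂ (untouched safe pw w∉R mw∉R))

    open-pair n R S safe fuel with ∃? (λ v → paired? v ×-dec ¬? (v ∈? R) ×-dec ¬? (mate v ∈? R))
    ... | yes (v , pv , v∉R , mv∉R) =
      claim n R S v (v∉R , proj₁ (untouched safe pv v∉R mv∉R)) (safe-claim v safe) fuel
    ... | no no-unmet = won (meets⇒resolving R meets)
      where
      meets : Meets Paired mate R
      meets u pu with u ∈? R | mate u ∈? R
      ... | yes u∈R | _ = inj₁ u∈R
      ... | no _ | yes mu∈R = inj₂ mu∈R
      ... | no u∉R | no mu∉R = ⊥-elim (no-unmet (u , pu , u∉R , mu∉R))

    empty-safe : Safe [] []
    empty-safe _ _ = inj₂ ((λ ()) , (λ ()))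

    wins-first : ResolverWins E [] [] (#unclaimed [] vertices)
    wins-first = open-pair _ [] [] empty-safe ≤-refl

    wins-second : ∀ w → ResolverWins E [] (w ∷ []) (#unclaimed [] vertices)
    wins-second w = answer _ [] [] w empty-safe ((λ ()) , (λ ())) ≤-refl

subsets : (n : ℕ) → List (Subset n)
subsets zero = [] ∷ []
subsets (suc n) = map (outside ∷_) (subsets n) ++ map (inside ∷_) (subsets n)

∈-subsets : ∀ {n} (S : Subset n) → S ∈ subsets n
∈-subsets [] = here refl
∈-subsets {suc n} (outside ∷ S) = ∈-++⁺ˡ (∈-map⁺ (outside ∷_) (∈-subsets S))
∈-subsets {suc n} (inside ∷ S) =
  ∈-++⁺ʳ (map (outside ∷_) (subsets n)) (∈-map⁺ (inside ∷_) (∈-subsets S))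

separating-element : ∀ {n} {S T : Subset n} → S ≢ T →
  Σ (Fin n) λ j → (j ∈ₛ S × j ∉ₛ T) ⊎ (j ∉ₛ S × j ∈ₛ T)
separating-element {S = S} {T} S≢T
  with anyᶠ? (λ j → (j ∈ₛ? S ×-dec ¬? (j ∈ₛ? T)) ⊎-dec (¬? (j ∈ₛ? S) ×-dec j ∈ₛ? T))
... | yes separated = separated
... | no none = ⊥-elim (S≢T (⊆-antisym S⊆T T⊆S))
  where
  S⊆T : S ⊆ T
  S⊆T {j} j∈S with j ∈ₛ? T
  ... | yes j∈T = j∈T
  ... | no j∉T = ⊥-elim (none (j , inj₁ (j∈S , j∉T)))
  T⊆S : T ⊆ S
  T⊆S {j} j∈T with j ∈ₛ? S
  ... | yes j∈S = j∈S
  ... | no j∉S = ⊥-elim (none (j , inj₂ (j∉S , j∈T)))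

third-element : ∀ {n} → 3 ≤ n → (i l : Fin n) → Σ (Fin n) λ j → j ≢ i × j ≢ l
third-element (s≤s (s≤s (s≤s _))) = third
  where
  third : ∀ {n} (i l : Fin (suc (suc (suc n)))) → Σ (Fin (suc (suc (suc n)))) λ j → j ≢ i × j ≢ l
  third (suc i) (suc l) = zero , (λ ()) , (λ ())
  third zero zero = suc zero , (λ ()) , (λ ())
  third zero (suc zero) = suc (suc zero) , (λ ()) , (λ ())
  third zero (suc (suc l)) = suc zero , (λ ()) , (λ ())
  third (suc zero) zero = suc (suc zero) , (λ ()) , (λ ())
  third (suc (suc i)) zero = suc zero , (λ ()) , (λ ())

module Gk (k : ℕ) (3≤k : 3 ≤ k) where

  V : Set
  V = VG k

  E : V → V → Set
  E = AdjG {k}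

  some-element : Fin k
  some-element = fromℕ< (≤-trans (s≤s z≤n) 3≤k)

  _≟ₛ_ : DecidableEquality (Subset k)
  _≟ₛ_ = ≡-dec _≟ᵇ_

  ⁅⁆-nonempty : (i : Fin k) → Nonempty ⁅ i ⁆
  ⁅⁆-nonempty i = i , x∈⁅x⁆ i

  -- The non-emptiness proof inside a vertex is irrelevant; being
  -- decidable, it can be recovered.
  nonempty : (S : Subset k) → .(Nonempty S) → Nonempty S
  nonempty S p with nonempty? S
  ... | yes ne = ne
  ... | no empty = ⊥-elim-irr (empty p)

  E-sym : ∀ {x y} → E x y → E y x
  E-sym (aa i≢j) = aa (λ j≡i → i≢j (sym j≡i))
  E-sym (bb {p = p} {q} S≢T) = bb {p = q} {p} (λ T≡S → S≢T (sym T≡S))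
  E-sym (cc {p = p} {q} S≢T) = cc {p = q} {p} (λ T≡S → S≢T (sym T≡S))
  E-sym (ab {p = p} i∈S) = ba {p = p} i∈S
  E-sym (ba {p = p} i∈S) = ab {p = p} i∈S
  E-sym (bc {p = p} {q}) = cb {p = q} {p}
  E-sym (cb {p = p} {q}) = bc {p = q} {p}

  open Reversal {E = E} E-sym

  -- The distances in G_k: A, B and C are cliques, a_i – b_S is an edge
  -- iff i ∈ S (otherwise a_i – b_{i} – b_S), and c_S hangs off b_S.
  dist : V → V → ℕ
  dist (a i) (a j) = δ (i ≟ᶠ j)
  dist (a i) (b S _) = 1 + δ (i ∈ₛ? S)
  dist (a i) (c S _) = 2 + δ (i ∈ₛ? S)
  dist (b S _) (a i) = 1 + δ (i ∈ₛ? S)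
  dist (b S _) (b T _) = δ (S ≟ₛ T)
  dist (b S _) (c T _) = 1 + δ (S ≟ₛ T)
  dist (c S _) (a i) = 2 + δ (i ∈ₛ? S)
  dist (c S _) (b T _) = 1 + δ (T ≟ₛ S)
  dist (c S _) (c T _) = δ (S ≟ₛ T)

  same : ∀ S → δ (S ≟ₛ S) ≡ 0
  same S = δ-yes (S ≟ₛ S) refl

  differ : ∀ {S T} → S ≢ T → δ (S ≟ₛ T) ≡ 1
  differ {S} {T} = δ-no (S ≟ₛ T)

  path-ab : ∀ i S .p → Walk E (a i) (b S p) (dist (a i) (b S p))
  path-ab i S p with i ∈ₛ? S
  ... | yes i∈S = cons (ab {p = nonempty S p} i∈S) nil
  ... | no i∉S =
    cons (ab {p = ⁅⁆-nonempty i} (x∈⁅x⁆ i)) (cons (bb {p = ⁅⁆-nonempty i} {nonempty S p} ⁅i⁆≢S) nil)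
    where
    ⁅i⁆≢S : ⁅ i ⁆ ≢ S
    ⁅i⁆≢S ⁅i⁆≡S = i∉S (subst (i ∈ₛ_) ⁅i⁆≡S (x∈⁅x⁆ i))

  path-bb : ∀ S .p T .q → Walk E (b S p) (b T q) (dist (b S p) (b T q))
  path-bb S p T q with S ≟ₛ T
  ... | yes refl = nil
  ... | no S≢T = cons (bb {p = nonempty S p} {nonempty T q} S≢T) nil

  path : ∀ x y → Walk E x y (dist x y)
  path (a i) (a j) with i ≟ᶠ j
  ... | yes refl = nil
  ... | no i≢j = cons (aa i≢j) nil
  path (a i) (b S p) = path-ab i S p
  path (a i) (c S p) = snoc (path-ab i S p) (bc {p = nonempty S p} {nonempty S p})
  path (b S p) (a i) = reverse (path-ab i S p)
  path (b S p) (b T q) = path-bb S p T q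
  path (b S p) (c T q) = snoc (path-bb S p T q) (bc {p = nonempty T q} {nonempty T q})
  path (c S p) (a i) = reverse (snoc (path-ab i S p) (bc {p = nonempty S p} {nonempty S p}))
  path (c S p) (b T q) = reverse (snoc (path-bb T q S p) (bc {p = nonempty S p} {nonempty S p}))
  path (c S p) (c T q) with S ≟ₛ T
  ... | yes refl = nil
  ... | no S≢T = cons (cc {p = nonempty S p} {nonempty T q} S≢T) nil

  dist-refl : ∀ x → dist x x ≡ 0
  dist-refl (a i) = δ-yes (i ≟ᶠ i) refl
  dist-refl (b S _) = δ-yes (S ≟ₛ S) refl
  dist-refl (c S _) = δ-yes (S ≟ₛ S) refl

  dist≤1 : ∀ {x y} → E x y → dist x y ≤ 1
  dist≤1 (aa {i} {j} _) = δ≤1 (i ≟ᶠ j)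
  dist≤1 (bb {S} {T} _) = δ≤1 (S ≟ₛ T)
  dist≤1 (cc {S} {T} _) = δ≤1 (S ≟ₛ T)
  dist≤1 (ab {i} {S} i∈S) = ≤-reflexive (cong suc (δ-yes (i ∈ₛ? S) i∈S))
  dist≤1 (ba {i} {S} i∈S) = ≤-reflexive (cong suc (δ-yes (i ∈ₛ? S) i∈S))
  dist≤1 (bc {S}) = ≤-reflexive (cong suc (δ-yes (S ≟ₛ S) refl))
  dist≤1 (cb {S}) = ≤-reflexive (cong suc (δ-yes (S ≟ₛ S) refl))

  δ-bound : ∀ n {m} {P : Set} (d : Dec P) → n + 1 ≤ m → n + δ d ≤ m
  δ-bound n d n+1≤m = ≤-trans (+-monoʳ-≤ n (δ≤1 d)) n+1≤m

  dist≤2 : ∀ {x u y} → E x u → E u y → dist x y ≤ 2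
  dist≤2 {a i} {_} {a j} _ _ = δ-bound 0 (i ≟ᶠ j) (s≤s z≤n)
  dist≤2 {a i} {_} {b S _} _ _ = δ-bound 1 (i ∈ₛ? S) ≤-refl
  dist≤2 {a i} {_} {c S _} (ab i∈S) bc = ≤-reflexive (cong (2 +_) (δ-yes (i ∈ₛ? S) i∈S))
  dist≤2 {b S _} {_} {a i} _ _ = δ-bound 1 (i ∈ₛ? S) ≤-refl
  dist≤2 {b S _} {_} {b T _} _ _ = δ-bound 0 (S ≟ₛ T) (s≤s z≤n)
  dist≤2 {b S _} {_} {c T _} _ _ = δ-bound 1 (S ≟ₛ T) ≤-refl
  dist≤2 {c S _} {_} {a i} cb (ba i∈S) = ≤-reflexive (cong (2 +_) (δ-yes (i ∈ₛ? S) i∈S))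
  dist≤2 {c S _} {_} {b T _} _ _ = δ-bound 1 (T ≟ₛ S) ≤-refl
  dist≤2 {c S _} {_} {c T _} _ _ = δ-bound 0 (S ≟ₛ T) (s≤s z≤n)

  dist≤3 : ∀ x y → dist x y ≤ 3
  dist≤3 (a i) (a j) = δ-bound 0 (i ≟ᶠ j) (s≤s z≤n)
  dist≤3 (a i) (b S _) = δ-bound 1 (i ∈ₛ? S) (s≤s (s≤s z≤n))
  dist≤3 (a i) (c S _) = δ-bound 2 (i ∈ₛ? S) ≤-refl
  dist≤3 (b S _) (a i) = δ-bound 1 (i ∈ₛ? S) (s≤s (s≤s z≤n))
  dist≤3 (b S _) (b T _) = δ-bound 0 (S ≟ₛ T) (s≤s z≤n)
  dist≤3 (b S _) (c T _) = δ-bound 1 (S ≟ₛ T) (s≤s (s≤s z≤n))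
  dist≤3 (c S _) (a i) = δ-bound 2 (i ∈ₛ? S) ≤-refl
  dist≤3 (c S _) (b T _) = δ-bound 1 (T ≟ₛ S) (s≤s (s≤s z≤n))
  dist≤3 (c S _) (c T _) = δ-bound 0 (S ≟ₛ T) (s≤s z≤n)

  -- No walk is shorter than dist: check walks of length at most two,
  -- and use that every distance is at most 3.
  shortest : ∀ {x y m} → Walk E x y m → dist x y ≤ m
  shortest {x} nil = ≤-reflexive (dist-refl x)
  shortest (cons e nil) = dist≤1 e
  shortest (cons e (cons e′ nil)) = dist≤2 e e′
  shortest {x} {y} (cons _ (cons _ (cons _ w))) = ≤-trans (dist≤3 x y) (s≤s (s≤s (s≤s z≤n)))

  open Distance E dist path shortest

  _≟ᵥ_ : DecidableEquality V
  a i ≟ᵥ a j with i ≟ᶠ j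
  ... | yes refl = yes refl
  ... | no i≢j = no λ { refl → i≢j refl }
  b S _ ≟ᵥ b T _ with S ≟ₛ T
  ... | yes refl = yes refl
  ... | no S≢T = no λ { refl → S≢T refl }
  c S _ ≟ᵥ c T _ with S ≟ₛ T
  ... | yes refl = yes refl
  ... | no S≢T = no λ { refl → S≢T refl }
  a _ ≟ᵥ b _ _ = no λ ()
  a _ ≟ᵥ c _ _ = no λ ()
  b _ _ ≟ᵥ a _ = no λ ()
  b _ _ ≟ᵥ c _ _ = no λ ()
  c _ _ ≟ᵥ a _ = no λ ()
  c _ _ ≟ᵥ b _ _ = no λ ()

  over-nonempty : ((S : Subset k) → .(Nonempty S) → V) → Subset k → List V
  over-nonempty v S with nonempty? S
  ... | yes p = v S p ∷ []
  ... | no _ = []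

  ∈-over-nonempty : ∀ v S .p → v S p ∈ over-nonempty v S
  ∈-over-nonempty v S p with nonempty? S
  ... | yes _ = here refl
  ... | no empty = ⊥-elim-irr (empty p)

  A : List V
  A = map a (allFin k)

  a∈A : ∀ j → a j ∈ A
  a∈A j = ∈-map⁺ a (∈-allFin j)

  vertices : List V
  vertices = A ++ concatMap (over-nonempty b) (subsets k)
               ++ concatMap (over-nonempty c) (subsets k)

  ∈-vertices : ∀ v → v ∈ vertices
  ∈-vertices (a i) = ∈-++⁺ˡ (a∈A i)
  ∈-vertices (b S p) =
    ∈-++⁺ʳ A (∈-++⁺ˡ (∈-concatMap⁺ (over-nonempty b) (lose (∈-subsets S) (∈-over-nonempty b S p))))
  ∈-vertices (c S p) = ∈-++⁺ʳ A (∈-++⁺ʳ (concatMap (over-nonempty b) (subsets k))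
                         (∈-concatMap⁺ (over-nonempty c) (lose (∈-subsets S) (∈-over-nonempty c S p))))

  open FiniteGraph E _≟ᵥ_ vertices ∈-vertices distinguishes?

  δ-separates : ∀ {j : Fin k} {S T : Subset k} →
    (j ∈ₛ S × j ∉ₛ T) ⊎ (j ∉ₛ S × j ∈ₛ T) → δ (j ∈ₛ? S) ≢ δ (j ∈ₛ? T)
  δ-separates {j} {S} {T} (inj₁ (j∈S , j∉T)) = δ-differ (j ∈ₛ? S) (j ∈ₛ? T) j∈S j∉T
  δ-separates {j} {S} {T} (inj₂ (j∉S , j∈T)) eq = δ-differ (j ∈ₛ? T) (j ∈ₛ? S) j∈T j∉S (sym eq)

  A-resolves : Resolving E A
  A-resolves (a i) y ai≢y = a i , a∈A i , self-distinguishes λ y≡ai → ai≢y (sym y≡ai)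
  A-resolves x (a i) x≢ai = a i , a∈A i , distinguishes-sym (self-distinguishes x≢ai)
  A-resolves (b S _) (b T _) bS≢bT with separating-element {S = S} {T} (λ { refl → bS≢bT refl })
  ... | j , separated = a j , a∈A j , distinguishes λ eq → δ-separates separated (suc-injective eq)
  A-resolves (c S _) (c T _) cS≢cT with separating-element {S = S} {T} (λ { refl → cS≢cT refl })
  ... | j , separated =
    a j , a∈A j , distinguishes λ eq → δ-separates separated (suc-injective (suc-injective eq))
  A-resolves (b S p) (c T _) _ with nonempty S p
  ... | j , j∈S = a j , a∈A j , distinguishes-by (cong suc (δ-yes (j ∈ₛ? S) j∈S)) refl λ ()
  A-resolves (c T _) (b S p) _ with nonempty S p
  ... | j , j∈S =
    a j , a∈A j , distinguishes-sym (distinguishes-by (cong suc (δ-yes (j ∈ₛ? S) j∈S)) refl λ ())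

  an-element : Subset k → Fin k
  an-element S with nonempty? S
  ... | yes (j , _) = j
  ... | no _ = some-element

  an-element-⁅⁆ : ∀ j → an-element ⁅ j ⁆ ≡ j
  an-element-⁅⁆ j with nonempty? ⁅ j ⁆
  ... | yes (m , m∈⁅j⁆) = x∈⁅y⁆⇒x≡y j m∈⁅j⁆
  ... | no empty = ⊥-elim (empty (⁅⁆-nonempty j))

  third-set : ∀ S T → Σ (Subset k) λ U → Nonempty U × U ≢ S × U ≢ T
  third-set S T with third-element 3≤k (an-element S) (an-element T)
  ... | j , j≢S , j≢T =
    ⁅ j ⁆ , ⁅⁆-nonempty j , (λ eq → j≢S (trans (sym (an-element-⁅⁆ j)) (cong an-element eq))) ,
                            (λ eq → j≢T (trans (sym (an-element-⁅⁆ j)) (cong an-element eq)))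

  another-set-containing : ∀ i S → Σ (Subset k) λ U → i ∈ₛ U × U ≢ S
  another-set-containing i S with S ≟ₛ ⁅ i ⁆
  ... | no S≢⁅i⁆ = ⁅ i ⁆ , x∈⁅x⁆ i , λ eq → S≢⁅i⁆ (sym eq)
  ... | yes refl with third-element 3≤k i i
  ...   | j , j≢i , _ = ⊤ , ∈⊤ , λ eq → j≢i (x∈⁅y⁆⇒x≡y i (subst (j ∈ₛ_) eq ∈⊤))

  PairDistinguishes : V → V → Set
  PairDistinguishes x y = Σ (Subset k) λ U → Σ (Nonempty U) λ p →
    Distinguishes E (b U p) x y × Distinguishes E (c U p) x y

  swap-pair : ∀ {x y} → PairDistinguishes x y → PairDistinguishes y x
  swap-pair (U , p , by-b , by-c) = U , p , distinguishes-sym by-b , distinguishes-sym by-c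

  pair-distinguishes : ∀ x y → x ≢ y → PairDistinguishes x y
  pair-distinguishes (a i) (a j) ai≢aj =
    ⁅ i ⁆ , ⁅⁆-nonempty i ,
    distinguishes-by (cong (1 +_) i∈) (cong (1 +_) j∉) (λ ()) ,
    distinguishes-by (cong (2 +_) i∈) (cong (2 +_) j∉) (λ ())
    where
    i∈ : δ (i ∈ₛ? ⁅ i ⁆) ≡ 0
    i∈ = δ-yes (i ∈ₛ? ⁅ i ⁆) (x∈⁅x⁆ i)
    j∉ : δ (j ∈ₛ? ⁅ i ⁆) ≡ 1
    j∉ = δ-no (j ∈ₛ? ⁅ i ⁆) λ j∈⁅i⁆ → ai≢aj (cong a (sym (x∈⁅y⁆⇒x≡y i j∈⁅i⁆)))
  pair-distinguishes (a i) (b S p) _ =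
    S , nonempty S p ,
    distinguishes-by refl (same S) (λ ()) ,
    distinguishes-by refl (cong (1 +_) (same S)) (λ ())
  pair-distinguishes (a i) (c S p) _ with another-set-containing i S
  ... | U , i∈U , U≢S =
    U , (i , i∈U) ,
    distinguishes-by (cong (1 +_) (δ-yes (i ∈ₛ? U) i∈U)) (cong (1 +_) (differ U≢S)) (λ ()) ,
    distinguishes-by (cong (2 +_) (δ-yes (i ∈ₛ? U) i∈U)) (differ (λ eq → U≢S (sym eq))) (λ ())
  pair-distinguishes (b S p) (b T _) bS≢bT =
    S , nonempty S p ,
    distinguishes-by (same S) (differ T≢S) (λ ()) ,
    distinguishes-by (cong (1 +_) (same S)) (cong (1 +_) (differ T≢S)) (λ ())
    where
    T≢S : T ≢ S
    T≢S refl = bS≢bT refl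
  pair-distinguishes (c S p) (c T _) cS≢cT =
    S , nonempty S p ,
    distinguishes-by (cong (1 +_) (same S)) (cong (1 +_) (differ S≢T)) (λ ()) ,
    distinguishes-by (same S) (differ (λ eq → S≢T (sym eq))) (λ ())
    where
    S≢T : S ≢ T
    S≢T refl = cS≢cT refl
  pair-distinguishes (b S p) (c T q) _ with S ≟ₛ T
  ... | yes refl =
    S , nonempty S p ,
    distinguishes-by (same S) (cong (1 +_) (same S)) (λ ()) ,
    distinguishes-by (cong (1 +_) (same S)) (same S) (λ ())
  ... | no S≢T with third-set S T
  ...   | U , U-nonempty , U≢S , U≢T =
    U , U-nonempty ,
    distinguishes-by (differ (λ eq → U≢S (sym eq))) (cong (1 +_) (differ U≢T)) (λ ()) ,
    distinguishes-by (cong (1 +_) (differ (λ eq → U≢S (sym eq)))) (differ (λ eq → U≢T (sym eq))) (λ ())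
  pair-distinguishes x@(b _ _) y@(a _) x≢y = swap-pair (pair-distinguishes y x λ eq → x≢y (sym eq))
  pair-distinguishes x@(c _ _) y@(a _) x≢y = swap-pair (pair-distinguishes y x λ eq → x≢y (sym eq))
  pair-distinguishes x@(c _ _) y@(b _ _) x≢y = swap-pair (pair-distinguishes y x λ eq → x≢y (sym eq))

  -- The pairs {b_S , c_S}; the vertices of A are left unpaired.
  Paired : V → Set
  Paired (a _) = ⊥
  Paired (b _ _) = Unit
  Paired (c _ _) = Unit

  paired? : ∀ v → Dec (Paired v)
  paired? (a _) = no λ ()
  paired? (b _ _) = yes tt
  paired? (c _ _) = yes tt

  mate : V → V
  mate (a i) = a i
  mate (b S p) = c S p
  mate (c S p) = b S p

  mate-paired : ∀ {v} → Paired v → Paired (mate v)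
  mate-paired {b _ _} _ = tt
  mate-paired {c _ _} _ = tt

  mate-involutive : ∀ {v} → Paired v → mate (mate v) ≡ v
  mate-involutive {b _ _} _ = refl
  mate-involutive {c _ _} _ = refl

  mate-distinct : ∀ {v} → Paired v → mate v ≢ v
  mate-distinct {b _ _} _ ()
  mate-distinct {c _ _} _ ()

  meets⇒resolving : ∀ R → Meets Paired mate R → Resolving E R
  meets⇒resolving R meets x y x≢y with pair-distinguishes x y x≢y
  ... | U , p , by-b , by-c with meets (b U p) tt
  ...   | inj₁ bU∈R = b U p , bU∈R , by-b
  ...   | inj₂ cU∈R = c U p , cU∈R , by-c

  open Pairing Paired paired? mate mate-paired mate-involutive mate-distinct meets⇒resolving
  open import Data.List.Membership.DecPropositional _≟ᵥ_ using (_∈?_)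

  label : V → Maybe (Subset k)
  label (a _) = nothing
  label (b S _) = just S
  label (c S _) = just S

  label-view : ∀ z → (Σ (Fin k) λ j → z ≡ a j) ⊎ (Σ (Subset k) λ X → label z ≡ just X)
  label-view (a j) = inj₁ (j , refl)
  label-view (b X _) = inj₂ (X , refl)
  label-view (c X _) = inj₂ (X , refl)

  a-distinguisher : ∀ {j S T} .{p : Nonempty S} .{q : Nonempty T} →
    Distinguishes E (a j) (b S p) (b T q) → (j ∈ₛ S → j ∈ₛ T) → (j ∈ₛ T → j ∈ₛ S) → ⊥
  a-distinguisher {j} {S} {T} d S→T T→S =
    distinguishes⁻ d (cong suc (δ-agree (j ∈ₛ? S) (j ∈ₛ? T) S→T T→S))

  labelled-distinguisher : ∀ {z X S T} .{p : Nonempty S} .{q : Nonempty T} →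
    label z ≡ just X → Distinguishes E z (b S p) (b T q) → X ≡ S ⊎ X ≡ T
  labelled-distinguisher {z} {X} {S} {T} {p} {q} labelled d with X ≟ₛ S | X ≟ₛ T
  ... | yes X≡S | _ = inj₁ X≡S
  ... | no _ | yes X≡T = inj₂ X≡T
  ... | no X≢S | no X≢T = ⊥-elim (distinguishes⁻ d (same-distance z labelled))
    where
    same-distance : ∀ z → label z ≡ just X → dist (b S p) z ≡ dist (b T q) z
    same-distance (b X _) refl = trans (differ (X≢S ∘ sym)) (sym (differ (X≢T ∘ sym)))
    same-distance (c X _) refl = cong suc (trans (differ (X≢S ∘ sym)) (sym (differ (X≢T ∘ sym))))

  module AvoidingA (i : Fin k) (W : List V) (resolves : Resolving E W) (ai∉W : a i ∉ W) where

    -- U l = A ∖ {i , l}; for k ≥ 3 these are k distinct non-empty sets.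
    U : Fin k → Subset k
    U l = ∁ (⁅ i ⁆ ∪ ⁅ l ⁆)

    ∈U : ∀ {j l} → j ≢ i → j ≢ l → j ∈ₛ U l
    ∈U {j} {l} j≢i j≢l = x∉p⇒x∈∁p λ j∈ → excluded (x∈p∪q⁻ ⁅ i ⁆ ⁅ l ⁆ j∈)
      where
      excluded : j ∈ₛ ⁅ i ⁆ ⊎ j ∈ₛ ⁅ l ⁆ → ⊥
      excluded (inj₁ j∈⁅i⁆) = j≢i (x∈⁅y⁆⇒x≡y i j∈⁅i⁆)
      excluded (inj₂ j∈⁅l⁆) = j≢l (x∈⁅y⁆⇒x≡y l j∈⁅l⁆)

    ∈U⁻ : ∀ {j l} → j ∈ₛ U l → j ≢ i × j ≢ l
    ∈U⁻ {j} {l} j∈U = (λ { refl → x∈∁p⇒x∉p j∈U (x∈p∪q⁺ (inj₁ (x∈⁅x⁆ i))) }) ,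
                      (λ { refl → x∈∁p⇒x∉p j∈U (x∈p∪q⁺ (inj₂ (x∈⁅x⁆ l))) })

    U-nonempty : ∀ l → Nonempty (U l)
    U-nonempty l with third-element 3≤k i l
    ... | j , j≢i , j≢l = j , ∈U j≢i j≢l

    i∈U∪i : ∀ l → i ∈ₛ U l ∪ ⁅ i ⁆
    i∈U∪i l = x∈p∪q⁺ (inj₂ (x∈⁅x⁆ i))

    U≢U∪i : ∀ l → U l ≢ U l ∪ ⁅ i ⁆
    U≢U∪i l eq = proj₁ (∈U⁻ (subst (i ∈ₛ_) (sym eq) (i∈U∪i l))) refl

    -- T lies in block l when, apart from i, it consists of the elements
    -- other than l, i.e. T ∖ {i} = U l.
    Block : Fin k → Subset k → Set
    Block l T = ∀ j → j ≢ i → (j ∈ₛ T → j ≢ l) × (j ≢ l → j ∈ₛ T)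

    block-unique : ∀ {l l′ T} → Block l T → Block l′ T → l ≡ l′
    block-unique {l} {l′} in-l in-l′ with l ≟ᶠ l′ | l ≟ᶠ i
    ... | yes l≡l′ | _ = l≡l′
    ... | no l≢l′ | no l≢i = ⊥-elim (proj₁ (in-l l l≢i) (proj₂ (in-l′ l l≢i) l≢l′) refl)
    ... | no l≢l′ | yes refl = ⊥-elim (proj₁ (in-l′ l′ l′≢i) (proj₂ (in-l l′ l′≢i) l′≢i) refl)
      where
      l′≢i : l′ ≢ i
      l′≢i l′≡i = l≢l′ (sym l′≡i)

    block-agree : ∀ {l T T′ j} → Block l T → Block l T′ → j ≢ i → j ∈ₛ T → j ∈ₛ T′
    block-agree {j = j} in-l in-l′ j≢i j∈T = proj₂ (in-l′ j j≢i) (proj₁ (in-l j j≢i) j∈T)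

    U-block : ∀ l → Block l (U l)
    U-block l j j≢i = (λ j∈U → proj₂ (∈U⁻ j∈U)) , ∈U j≢i

    U∪i-block : ∀ l → Block l (U l ∪ ⁅ i ⁆)
    U∪i-block l j j≢i =
      (λ j∈ → from (x∈p∪q⁻ (U l) ⁅ i ⁆ j∈)) , λ j≢l → x∈p∪q⁺ (inj₁ (∈U j≢i j≢l))
      where
      from : j ∈ₛ U l ⊎ j ∈ₛ ⁅ i ⁆ → j ≢ l
      from (inj₁ j∈U) = proj₂ (∈U⁻ j∈U)
      from (inj₂ j∈⁅i⁆) = ⊥-elim (j≢i (x∈⁅y⁆⇒x≡y i j∈⁅i⁆))

    BlockVertex : Fin k → V → Set
    BlockVertex l z = Σ (Subset k) λ X → label z ≡ just X × Block l X

    block-vertex-unique : ∀ {l l′ z} → BlockVertex l z → BlockVertex l′ z → l ≡ l′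
    block-vertex-unique (X , labelled , in-l) (X′ , labelled′ , in-l′) =
      block-unique in-l (subst (Block _) (sym (just-injective (trans (sym labelled) labelled′))) in-l′)

    block-distinguisher : ∀ {l T T′ z} .{p : Nonempty T} .{q : Nonempty T′} →
      Block l T → Block l T′ → z ≢ a i → Distinguishes E z (b T p) (b T′ q) → BlockVertex l z
    block-distinguisher {z = z} in-l in-l′ z≢ai d with label-view z
    ... | inj₁ (j , refl) with j ≟ᶠ i
    ...   | yes refl = ⊥-elim (z≢ai refl)
    ...   | no j≢i = ⊥-elim (a-distinguisher d (block-agree in-l in-l′ j≢i) (block-agree in-l′ in-l j≢i))
    block-distinguisher {l} in-l in-l′ z≢ai d | inj₂ (X , labelled)
      with labelled-distinguisher labelled d
    ... | inj₁ X≡T = X , labelled , subst (Block l) (sym X≡T) in-l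
    ... | inj₂ X≡T′ = X , labelled , subst (Block l) (sym X≡T′) in-l′

    -- W contains a vertex of every block: it must distinguish b_{U l}
    -- from b_{U l ∪ {i}}.
    block-vertex : ∀ l → Σ V λ z → z ∈ W × BlockVertex l z
    block-vertex l
      with resolves (b (U l) (U-nonempty l)) (b (U l ∪ ⁅ i ⁆) (i , i∈U∪i l))
                    (λ eq → U≢U∪i l (just-injective (cong label eq)))
    ... | z , z∈W , d =
      z , z∈W , block-distinguisher (U-block l) (U∪i-block l) z≢ai d
      where
      z≢ai : z ≢ a i
      z≢ai z≡ai = ai∉W (subst (_∈ W) z≡ai z∈W)

    -- Vertices lying in no block: those of A and those labelled {i}.
    Outside : V → Set
    Outside z = label z ≡ nothing ⊎ label z ≡ just ⁅ i ⁆

    outside? : ∀ z → Dec (Outside z)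
    outside? z = ≡-decᵐ _≟ₛ_ (label z) nothing ⊎-dec ≡-decᵐ _≟ₛ_ (label z) (just ⁅ i ⁆)

    outside⇒no-block : ∀ {z l} → Outside z → ¬ BlockVertex l z
    outside⇒no-block (inj₁ unlabelled) (X , labelled , _) with trans (sym unlabelled) labelled
    ... | ()
    outside⇒no-block {l = l} (inj₂ labelled-i) (X , labelled , in-l) with third-element 3≤k i l
    ... | j , j≢i , j≢l = j≢i (x∈⁅y⁆⇒x≡y i (subst (j ∈ₛ_) X≡⁅i⁆ (proj₂ (in-l j j≢i) j≢l)))
      where
      X≡⁅i⁆ : X ≡ ⁅ i ⁆
      X≡⁅i⁆ = just-injective (trans (sym labelled) labelled-i)

    -- Case 1: an outside vertex of W together with one vertex per block.
    with-outside-vertex : ∀ {z₀} → z₀ ∈ W → Outside z₀ → k < length W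
    with-outside-vertex {z₀} z₀∈W z₀-outside = injection⇒≤length W f f-injective f∈W
      where
      f : Fin (suc k) → V
      f zero = z₀
      f (suc l) = proj₁ (block-vertex l)

      f∈W : ∀ m → f m ∈ W
      f∈W zero = z₀∈W
      f∈W (suc l) = proj₁ (proj₂ (block-vertex l))

      in-block : ∀ l → BlockVertex l (f (suc l))
      in-block l = proj₂ (proj₂ (block-vertex l))

      f-injective : ∀ {m m′} → f m ≡ f m′ → m ≡ m′
      f-injective {zero} {zero} _ = refl
      f-injective {zero} {suc l} eq =
        ⊥-elim (outside⇒no-block z₀-outside (subst (BlockVertex l) (sym eq) (in-block l)))
      f-injective {suc l} {zero} eq =
        ⊥-elim (outside⇒no-block z₀-outside (subst (BlockVertex l) eq (in-block l)))
      f-injective {suc l} {suc l′} eq =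
        cong suc (block-vertex-unique (in-block l) (subst (BlockVertex l′) (sym eq) (in-block l′)))

    -- Case 2: with no outside vertex, every non-empty T ≠ {i} labels a
    -- vertex of W, the one distinguishing b_{i} from b_T.
    labelled-vertex : (∀ z → z ∈ W → ¬ Outside z) → ∀ T → Nonempty T → T ≢ ⁅ i ⁆ →
      Σ V λ z → z ∈ W × label z ≡ just T
    labelled-vertex none-outside T T-nonempty T≢⁅i⁆
      with resolves (b ⁅ i ⁆ (⁅⁆-nonempty i)) (b T T-nonempty)
                    (λ eq → T≢⁅i⁆ (sym (just-injective (cong label eq))))
    ... | z , z∈W , d with label-view z
    ...   | inj₁ (j , refl) = ⊥-elim (none-outside z z∈W (inj₁ refl))
    ...   | inj₂ (X , labelled) with labelled-distinguisher labelled d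
    ...     | inj₁ X≡⁅i⁆ = ⊥-elim (none-outside z z∈W (inj₂ (trans labelled (cong just X≡⁅i⁆))))
    ...     | inj₂ X≡T = z , z∈W , trans labelled (cong just X≡T)

    without-outside-vertex : (∀ z → z ∈ W → ¬ Outside z) → k < length W
    without-outside-vertex none-outside = injection⇒≤length W f f-injective f∈W
      where
      -- k + 1 distinct non-empty sets other than {i}: A itself and the U l.
      F : Fin (suc k) → Subset k
      F zero = ⊤
      F (suc l) = U l

      F-nonempty : ∀ m → Nonempty (F m)
      F-nonempty zero = i , ∈⊤
      F-nonempty (suc l) = U-nonempty l

      F≢⁅i⁆ : ∀ m → F m ≢ ⁅ i ⁆
      F≢⁅i⁆ zero ⊤≡⁅i⁆ with third-element 3≤k i i
      ... | j , j≢i , _ = j≢i (x∈⁅y⁆⇒x≡y i (subst (j ∈ₛ_) ⊤≡⁅i⁆ ∈⊤))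
      F≢⁅i⁆ (suc l) U≡⁅i⁆ = proj₁ (∈U⁻ (subst (i ∈ₛ_) (sym U≡⁅i⁆) (x∈⁅x⁆ i))) refl

      F-injective : ∀ {m m′} → F m ≡ F m′ → m ≡ m′
      F-injective {zero} {zero} _ = refl
      F-injective {zero} {suc l} ⊤≡U = ⊥-elim (proj₁ (∈U⁻ (subst (i ∈ₛ_) ⊤≡U ∈⊤)) refl)
      F-injective {suc l} {zero} U≡⊤ = ⊥-elim (proj₁ (∈U⁻ (subst (i ∈ₛ_) (sym U≡⊤) ∈⊤)) refl)
      F-injective {suc l} {suc l′} U≡U′ =
        cong suc (block-unique (U-block l) (subst (Block l′) (sym U≡U′) (U-block l′)))

      vertex : ∀ m → Σ V λ z → z ∈ W × label z ≡ just (F m)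
      vertex m = labelled-vertex none-outside (F m) (F-nonempty m) (F≢⁅i⁆ m)

      f : Fin (suc k) → V
      f m = proj₁ (vertex m)

      f∈W : ∀ m → f m ∈ W
      f∈W m = proj₁ (proj₂ (vertex m))

      f-labelled : ∀ m → label (f m) ≡ just (F m)
      f-labelled m = proj₂ (proj₂ (vertex m))

      f-injective : ∀ {m m′} → f m ≡ f m′ → m ≡ m′
      f-injective {m} {m′} eq =
        F-injective (just-injective (trans (sym (f-labelled m)) (trans (cong label eq) (f-labelled m′))))

    avoiding-a⇒large : k < length W
    avoiding-a⇒large with any? outside? W
    ... | yes found = let (z₀ , z₀∈W , z₀-outside) = find found in with-outside-vertex z₀∈W z₀-outside
    ... | no none = without-outside-vertex λ z z∈W z-outside → none (lose z∈W z-outside)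

  open AvoidingA using (avoiding-a⇒large)

  a-injective : ∀ {i j : Fin k} → a i ≡ a j → i ≡ j
  a-injective refl = refl

  -- dim(G_k) = k: A resolves, and a resolving set either contains all of
  -- A or misses some a_i and then has more than k vertices.
  dimension : IsMetricDim E k
  dimension = (A , A-unique , A-length , A-resolves) , λ W _ → at-least-k W
    where
    A-unique : Unique A
    A-unique = map⁺ a-injective (allFin⁺ k)
    A-length : length A ≡ k
    A-length = trans (length-map a (allFin k)) (length-tabulate (λ j → j))
    at-least-k : ∀ W → Resolving E W → k ≤ length W
    at-least-k W res with allᶠ? (λ i → a i ∈? W)
    ... | yes all-a = injection⇒≤length W a a-injective all-a
    ... | no ¬all-a with ¬∀⟶∃¬ k _ (λ i → a i ∈? W) ¬all-a
    ...   | i , ai∉W = <⇒≤ (avoiding-a⇒large i W res ai∉W)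

  -- Whatever Resolver picks first, Spoiler can take a vertex a_i of A
  -- different from it, after which Resolver needs more than k vertices.
  no-win-within-k : ∀ m → m ≤ k → ¬ ResolverWins E [] [] m
  no-win-within-k = no-win-within (a some-element) steal
    where
    other-than : V → Fin k
    other-than (a j) = proj₁ (third-element 3≤k j j)
    other-than _ = some-element
    other-than-≢ : ∀ v → a (other-than v) ≢ v
    other-than-≢ (a j) eq = proj₁ (proj₂ (third-element 3≤k j j)) (a-injective eq)
    other-than-≢ (b _ _) ()
    other-than-≢ (c _ _) ()
    steal : ∀ v → Σ V λ u → u ≢ v × ∀ W → Resolving E W → u ∉ W → k < length W
    steal v = a (other-than v) , other-than-≢ v , avoiding-a⇒large (other-than v)

  outcome : OutcomeResolver E
  outcome = (_ , wins-first) , λ w → _ , wins-second w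

  resolving-number : Σ ℕ λ r → IsRMB E r × k < r
  resolving-number
    with least-witness (λ m → ResolverWins E [] [] m) (λ m → resolverWins? m [] []) _ wins-first
  ... | r , least with r ≤? k
  ...   | yes r≤k = ⊥-elim (no-win-within-k r r≤k (proj₁ least))
  ...   | no r≰k = r , least , ≰⇒> r≰k

corollary3p7 : (k : ℕ) → 3 ≤ k →
    OutcomeResolver (AdjG {k}) ×
    Σ ℕ (λ d → Σ ℕ (λ r → IsMetricDim (AdjG {k}) d × IsRMB (AdjG {k}) r × d < r))
corollary3p7 k 3≤k =
  outcome , k , proj₁ resolving-number , dimension , proj₂ resolving-number
  where
  open Gk k 3≤k
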